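{- Let $r\ge3$ and let $T$ be a hypertree with two distinct edges $e_1,e_2$ satisfying $|e_1|=|e_2|=r$. Suppose $u_i,v_i\in e_i$ for $i=1,2$, that $d_T(u_1,u_2)=d_T(v_1,v_2)+2$, and that every vertex in $e_i\setminus\{u_i,v_i\}$ has degree one in $T$ ($i=1,2$). For $i=1,2$ let $T_i$ be the connected component of $T-e_i$ containing $u_i$, and let $x=x(T)$. Then for any $w_1\in e_1\setminus\{u_1,v_1\}$ and $w_2\in e_2\setminus\{u_2,v_2\}$, \[\rho(T)(x_{u_1}-x_{u_2})-(\rho(T)+1)(x_{w_1}-x_{w_2})=\sigma_T(T_2)-\sigma_T(T_1)\] and \[(\rho(T)+1)(x_{w_1}-x_{w_2})-\rho(T)(x_{v_1}-x_{v_2})=(r-2)(x_{w_2}-x_{w_1})+\sigma_T(T_2)-\sigma_T(T_1).\]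
   Context: A hypergraph $G$ has a finite vertex set and an edge set of subsets of the vertex set with at least two vertices each. The degree of a vertex is the number of edges containing it. A loose path of length $p$ is an alternating sequence $(v_0,e_1,v_1,\dots,e_p,v_p)$ of distinct vertices and distinct edges with $v_{i-1},v_i\in e_i$ and $e_i\cap e_j=\emptyset$ for $|i-j|>1$; $G$ is connected if any two vertices are joined by a loose path. A loose cycle of length $p$ is $(v_0,e_1,v_1,\dots,v_{p-1},e_p,v_0)$ with distinct vertices $v_0,\dots,v_{p-1}$, distinct edges, $v_{i-1},v_i\in e_i$ ($v_p=v_0$), and $e_i\cap e_j=\emptyset$ for $|i-j|>1$, $\{i,j\}\neq\{1,p\}$. A hypertree is a connected hypergraph without loose cycles. $d_T(u,v)$ is the length of a shortest loose path between $u$ and $v$; $D(T)=(d_T(u,v))$ is the distance matrix and $\rho(T)$ its largest eigenvalue. $x(T)$ denotes the distance Perron vector: the unique positive unit eigenvector of $D(T)$ for $\rho(T)$, with entries $x_v$. For a subhypergraph $H$, $\sigma_T(H)=\sum_{v\in V(H)}x_v$. $T-e$ denotes the subhypergraph obtained by deleting the edge $e$ (keeping all vertices). -}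

module Defs where

open import Level using (Level; suc; _⊔_)
open import Data.Nat using (ℕ; zero; _<_; _≤_) renaming (suc to sucℕ)
open import Data.Fin using (Fin)
open import Data.Fin.Subset using (Subset; _∈_; ∣_∣)
open import Data.Fin.Subset.Properties using (_∈?_)
open import Data.List using (List; length; filter; foldr; map)
open import Data.List using () renaming (_∷_ to _∷ₗ_)
open import Data.Fin.Base using () renaming (toℕ to toℕ)
open import Data.List.Base using ()
open import Data.Fin using () renaming (zero to fzero)
open import Data.Product using (Σ; ∃; _×_; _,_)
open import Data.Unit using (⊤)
import Data.Sum
open import Data.Empty using (⊥)
open import Relation.Nullary using (¬_; Dec; yes; no)
open import Relation.Binary.PropositionalEquality using (_≡_; _≢_)
open import Algebra.Bundles using (CommutativeRing)
open import Data.List.Base using (allFin)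

-- Ordered fields (agda-stdlib has no real numbers and no fields).

record OrderedField (c ℓ₁ ℓ₂ : Level) : Set (Level.suc (c ⊔ ℓ₁ ⊔ ℓ₂)) where
  field
    commRing : CommutativeRing c ℓ₁
  open CommutativeRing commRing public
  field
    _≤ᶠ_       : Carrier → Carrier → Set ℓ₂
    ≤ᶠ-refl    : ∀ {a b} → a ≈ b → a ≤ᶠ b
    ≤ᶠ-trans   : ∀ {a b c} → a ≤ᶠ b → b ≤ᶠ c → a ≤ᶠ c
    ≤ᶠ-antisym : ∀ {a b} → a ≤ᶠ b → b ≤ᶠ a → a ≈ b
    ≤ᶠ-total   : ∀ a b → (a ≤ᶠ b) Data.Sum.⊎ (b ≤ᶠ a)
    ≤ᶠ-resp-≈  : ∀ {a a′ b b′} → a ≈ a′ → b ≈ b′ → a ≤ᶠ b → a′ ≤ᶠ b′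
    +-mono-≤ᶠ  : ∀ {a b} c → a ≤ᶠ b → (a + c) ≤ᶠ (b + c)
    *-nonneg   : ∀ {a b} → 0# ≤ᶠ a → 0# ≤ᶠ b → 0# ≤ᶠ (a * b)
    0≉1        : ¬ (0# ≈ 1#)
    inverse    : ∀ a → ¬ (a ≈ 0#) → Σ Carrier λ b → (a * b) ≈ 1#

  _<ᶠ_ : Carrier → Carrier → Set (ℓ₁ ⊔ ℓ₂)
  a <ᶠ b = (a ≤ᶠ b) × ¬ (a ≈ b)

  fromℕ : ℕ → Carrier
  fromℕ zero     = 0#
  fromℕ (sucℕ k) = 1# + fromℕ k

  Σᶠ : ∀ {n} → (Fin n → Carrier) → Carrier
  Σᶠ {n} f = foldr _+_ 0# (map f (allFin n))

  Σ∈ : ∀ {n} → Subset n → (Fin n → Carrier) → Carrier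
  Σ∈ {n} S f = Σᶠ (λ v → sel (v ∈? S) (f v))
    where
    sel : ∀ {P : Set} → Dec P → Carrier → Carrier
    sel (yes _) a = a
    sel (no _)  _ = 0#

-- Hypergraphs on the vertex set Fin n with m edges, the edges being
-- given by an injective family E : Fin m → Subset n (edge set = image).

IsHypergraph : ∀ {n m} → (Fin m → Subset n) → Set
IsHypergraph {n} {m} E =
  (∀ (i j : Fin m) → E i ≡ E j → i ≡ j) × (∀ (i : Fin m) → 2 ≤ ∣ E i ∣)

Disjoint : ∀ {n} → Subset n → Subset n → Set
Disjoint A B = ∀ x → x ∈ A → x ∈ B → ⊥

degree : ∀ {n m} → (Fin m → Subset n) → Fin n → ℕ
degree {n} {m} E v = length (filter (λ j → v ∈? E j) (allFin m))

-- A loose path of length p from u to w whose edges all satisfy the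
-- predicate Allowed.  Vertices v 0 … v p, edges e 0 … e (p-1); the
-- paper's edge e_{i+1} is e i and joins v i and v (i+1).
record LoosePathIn {n m} (Allowed : Fin m → Set) (E : Fin m → Subset n)
                   (u w : Fin n) (p : ℕ) : Set where
  field
    v        : ℕ → Fin n
    e        : ℕ → Fin m
    start    : v 0 ≡ u
    end      : v p ≡ w
    v-inj    : ∀ i j → i ≤ p → j ≤ p → v i ≡ v j → i ≡ j
    e-inj    : ∀ i j → i < p → j < p → e i ≡ e j → i ≡ j
    allowed  : ∀ i → i < p → Allowed (e i)
    incl₁    : ∀ i → i < p → v i ∈ E (e i)
    incl₂    : ∀ i → i < p → v (sucℕ i) ∈ E (e i)
    disjoint : ∀ i j → i < p → j < p → sucℕ i < j → Disjoint (E (e i)) (E (e j))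

LoosePath : ∀ {n m} → (Fin m → Subset n) → Fin n → Fin n → ℕ → Set
LoosePath E u w p = LoosePathIn (λ _ → ⊤) E u w p

-- A loose cycle of length p ≥ 2: vertices v 0 … v (p-1), v p = v 0,
-- edges e 0 … e (p-1), e i containing v i and v (i+1).
record LooseCycle {n m} (E : Fin m → Subset n) (p : ℕ) : Set where
  field
    two≤p    : 2 ≤ p
    v        : ℕ → Fin n
    e        : ℕ → Fin m
    closed   : v p ≡ v 0
    v-inj    : ∀ i j → i < p → j < p → v i ≡ v j → i ≡ j
    e-inj    : ∀ i j → i < p → j < p → e i ≡ e j → i ≡ j
    incl₁    : ∀ i → i < p → v i ∈ E (e i)
    incl₂    : ∀ i → i < p → v (sucℕ i) ∈ E (e i)
    disjoint : ∀ i j → i < p → j < p → sucℕ i < j →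
               ¬ (i ≡ 0 × sucℕ j ≡ p) → Disjoint (E (e i)) (E (e j))

Connected : ∀ {n m} → (Fin m → Subset n) → Set
Connected E = ∀ u w → ∃ λ p → LoosePath E u w p

IsHypertree : ∀ {n m} → (Fin m → Subset n) → Set
IsHypertree E = IsHypergraph E × Connected E × (∀ p → ¬ LooseCycle E p)

IsDistance : ∀ {n m} → (Fin m → Subset n) → (Fin n → Fin n → ℕ) → Set
IsDistance E d = ∀ u w → LoosePath E u w (d u w) × (∀ p → LoosePath E u w p → d u w ≤ p)

-- C is the vertex set of the connected component of T - f containing u
-- (loose paths in T - f are exactly loose paths of T avoiding edge f)
IsComponentMinus : ∀ {n m} → (Fin m → Subset n) → Fin m → Fin n → Subset n → Set
IsComponentMinus E f u C =
  ∀ w → (w ∈ C → ∃ λ p → LoosePathIn (λ j → j ≢ f) E u w p)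
      × ((∃ λ p → LoosePathIn (λ j → j ≢ f) E u w p) → w ∈ C)

module Spectral {c ℓ₁ ℓ₂} (F : OrderedField c ℓ₁ ℓ₂) {n : ℕ} where
  open OrderedField F

  mulD : (Fin n → Fin n → ℕ) → (Fin n → Carrier) → Fin n → Carrier
  mulD d y u = Σᶠ (λ w → fromℕ (d u w) * y w)

  IsEigenvalue : (Fin n → Fin n → ℕ) → Carrier → Set (c ⊔ ℓ₁)
  IsEigenvalue d λ′ = Σ (Fin n → Carrier) λ y →
    (Σ (Fin n) λ w → ¬ (y w ≈ 0#)) × (∀ u → mulD d y u ≈ λ′ * y u)

  IsLargestEigenvalue : (Fin n → Fin n → ℕ) → Carrier → Set (c ⊔ ℓ₁ ⊔ ℓ₂)
  IsLargestEigenvalue d ρ = IsEigenvalue d ρ × (∀ λ′ → IsEigenvalue d λ′ → λ′ ≤ᶠ ρ)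

  IsPerronVector : (Fin n → Fin n → ℕ) → Carrier → (Fin n → Carrier) → Set (ℓ₁ ⊔ ℓ₂)
  IsPerronVector d ρ x =
    (∀ u → mulD d x u ≈ ρ * x u) × (∀ u → 0# <ᶠ x u) × (Σᶠ (λ u → x u * x u) ≈ 1#)

-- For a vertex z, let t_z be the vertex of the cut edge e whose component of T − e contains z.
-- Two vertices of e cannot both reach z outside e (a loose path outside e between two of its
-- vertices shortens until it closes up with e into a loose cycle), so for every y ∈ e
--   d(y, z) = d(t_z, z) + [y ≠ t_z].
-- Multiplying by x_z and summing over z turns the eigen-equation (D x)_y = ρ x_y into
--   ρ x_y + σ(y) = τ   for every y ∈ e,
-- where σ(y) is the x-mass of the vertices anchored at y and τ does not depend on y.  For a pendant
-- vertex w of e, σ(w) = x_w; σ(u) = σ_T(T_u); and the masses anchored at the r − 2 pendant vertices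
-- (which share the value x_w because ρ + 1 ≠ 0), at u and at v add up to Σ x.  Hence
--   ρ x_u + σ_T(T_u) = (ρ + 1) x_w   and   ρ x_v + Σ x = (ρ + 1) x_w + (r − 2) x_w + σ_T(T_u)
-- for each of e₁ and e₂, and subtracting the identities of the two edges gives both formulas.

module Submission where

open import Defs
open import Level using (Level)
open import Data.Nat using (ℕ; _∸_; _≤_) renaming (_+_ to _+ℕ_)
open import Data.Fin using (Fin)
open import Data.Fin.Subset using (Subset; _∈_; ∣_∣)
open import Data.Product using (_×_)
open import Relation.Binary.PropositionalEquality using (_≡_; _≢_)

open import Level using (0ℓ)
open import Algebra.Bundles using (CommutativeMonoid; CommutativeRing)
import Algebra.Properties.CommutativeMonoid.Sum as MonoidSum
open import Data.Bool using (true; false)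
open import Data.Empty using (⊥; ⊥-elim)
open import Data.Nat using (zero; suc; _<_; z≤n; s≤s)
import Data.Nat as ℕ
import Data.Nat.Properties as ℕ
import Data.Fin as Fin
import Data.Fin.Properties as Fin
open import Data.Fin.Subset using (_∉_; inside; outside)
open import Data.Fin.Subset.Properties using (_∈?_)
open import Data.List using ([]; _∷_; length; filter; allFin)
import Data.List as List
open import Data.List.Properties using (filter-some; filter-accept; map-tabulate)
open import Data.List.Membership.Propositional using () renaming (_∈_ to _∈ˡ_)
open import Data.List.Membership.Propositional.Properties using (∈-allFin)
open import Data.List.Relation.Unary.Any as Any using (here; there)
open import Data.Product using (∃-syntax; _,_; proj₁; proj₂)
open import Data.Sum using (_⊎_; inj₁; inj₂)
open import Data.Vec using ([]; _∷_)
open import Function using (_∘_; id)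
open import Relation.Nullary using (¬_; Dec; yes; no; ¬?; does)
open import Relation.Nullary.Decidable using (_×-dec_)
open import Relation.Unary using (Pred; Decidable)
import Relation.Binary.PropositionalEquality as ≡
open ≡ using (_≗_; module ≡-Reasoning)

-- The library's ring solver takes coefficients from a ring with decidable equality mapped into R.
module IntegerCoefficients {c ℓ} (R : CommutativeRing c ℓ) where
  open import Data.Integer as ℤ using (ℤ; +_; -[1+_])
  import Data.Integer.Properties as ℤ
  import Data.Sign as Sign
  open import Data.Maybe using (Maybe; just; nothing)
  open CommutativeRing R
  open import Algebra.Properties.Ring ring using (-‿distribʳ-*; -‿distribˡ-*; -0#≈0#; -‿involutive)
  open import Algebra.Properties.AbelianGroup +-abelianGroup using (⁻¹-∙-comm)
  open import Algebra.Properties.CommutativeSemigroup +-commutativeSemigroup using (interchange)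
  open import Algebra.Properties.Monoid.Mult +-monoid using (×-homo-+) renaming (_×_ to _×ₙ_)
  open import Algebra.Properties.Semiring.Mult semiring using (×1-homo-*)
  open import Algebra.Solver.Ring.AlmostCommutativeRing
  open import Relation.Binary.Reasoning.Setoid setoid

  fromℤ : ℤ → Carrier
  fromℤ (+ n)    = n ×ₙ 1#
  fromℤ -[1+ n ] = - (suc n ×ₙ 1#)

  ⊖-homo : ∀ m n → fromℤ (m ℤ.⊖ n) ≈ m ×ₙ 1# - n ×ₙ 1#
  ⊖-homo zero    zero    = sym (-‿inverseʳ 0#)
  ⊖-homo zero    (suc n) = sym (+-identityˡ _)
  ⊖-homo (suc m) zero    = sym (trans (+-congˡ -0#≈0#) (+-identityʳ _))
  ⊖-homo (suc m) (suc n) = begin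
    fromℤ (suc m ℤ.⊖ suc n)             ≡⟨ ≡.cong fromℤ (ℤ.[1+m]⊖[1+n]≡m⊖n m n) ⟩
    fromℤ (m ℤ.⊖ n)                     ≈⟨ ⊖-homo m n ⟩
    m ×ₙ 1# - n ×ₙ 1#                   ≈⟨ +-identityˡ _ ⟨
    0# + (m ×ₙ 1# - n ×ₙ 1#)            ≈⟨ +-congʳ (-‿inverseʳ 1#) ⟨
    (1# - 1#) + (m ×ₙ 1# - n ×ₙ 1#)     ≈⟨ interchange _ _ _ _ ⟩
    (1# + m ×ₙ 1#) + (- 1# - n ×ₙ 1#)   ≈⟨ +-congˡ (⁻¹-∙-comm _ _) ⟩
    (1# + m ×ₙ 1#) - (1# + n ×ₙ 1#)     ∎

  +-homo : ∀ i j → fromℤ (i ℤ.+ j) ≈ fromℤ i + fromℤ j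
  +-homo (+ m)      (+ n)      = ×-homo-+ 1# m n
  +-homo (+ m)      -[1+ n ]   = ⊖-homo m (suc n)
  +-homo -[1+ m ]   (+ n)      = trans (⊖-homo n (suc m)) (+-comm _ _)
  +-homo -[1+ m ]   -[1+ n ]   = begin
    - (suc (suc (m ℕ.+ n)) ×ₙ 1#)       ≡⟨ ≡.cong (λ k → - (suc k ×ₙ 1#)) (ℕ.+-suc m n) ⟨
    - ((suc m ℕ.+ suc n) ×ₙ 1#)         ≈⟨ -‿cong (×-homo-+ 1# (suc m) (suc n)) ⟩
    - (suc m ×ₙ 1# + suc n ×ₙ 1#)       ≈⟨ ⁻¹-∙-comm _ _ ⟨
    - (suc m ×ₙ 1#) + - (suc n ×ₙ 1#)   ∎

  *-homo : ∀ i j → fromℤ (i ℤ.* j) ≈ fromℤ i * fromℤ j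
  *-homo (+ m)      (+ n)      = trans (reflexive (≡.cong fromℤ (ℤ.+◃n≡+n (m ℕ.* n)))) (×1-homo-* m n)
  *-homo (+ zero)   -[1+ n ]   = sym (zeroˡ _)
  *-homo (+ suc m)  -[1+ n ]   = trans (-‿cong (×1-homo-* (suc m) (suc n))) (-‿distribʳ-* _ _)
  *-homo -[1+ m ]   (+ zero)   = trans (reflexive (≡.cong (λ k → fromℤ (Sign.- ℤ.◃ k)) (ℕ.*-zeroʳ m))) (sym (zeroʳ _))
  *-homo -[1+ m ]   (+ suc n)  = trans (-‿cong (×1-homo-* (suc m) (suc n))) (-‿distribˡ-* _ _)
  *-homo -[1+ m ]   -[1+ n ]   = begin
    (suc m ℕ.* suc n) ×ₙ 1#             ≈⟨ ×1-homo-* (suc m) (suc n) ⟩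
    suc m ×ₙ 1# * suc n ×ₙ 1#           ≈⟨ -‿involutive _ ⟨
    - - (suc m ×ₙ 1# * suc n ×ₙ 1#)     ≈⟨ -‿cong (-‿distribˡ-* _ _) ⟩
    - (- (suc m ×ₙ 1#) * suc n ×ₙ 1#)   ≈⟨ -‿distribʳ-* _ _ ⟩
    - (suc m ×ₙ 1#) * - (suc n ×ₙ 1#)   ∎

  -‿homo : ∀ i → fromℤ (ℤ.- i) ≈ - fromℤ i
  -‿homo (+ zero)  = sym -0#≈0#
  -‿homo (+ suc n) = refl
  -‿homo -[1+ n ]  = sym (-‿involutive _)

  morphism : ℤ.+-*-rawRing -Raw-AlmostCommutative⟶ fromCommutativeRing R
  morphism = record
    { ⟦_⟧ = fromℤ ; +-homo = +-homo ; *-homo = *-homo ; -‿homo = -‿homo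
    ; 0-homo = refl ; 1-homo = +-identityʳ 1# }

  _≟-image_ : ∀ i j → Maybe (fromℤ i ≈ fromℤ j)
  i ≟-image j with i ℤ.≟ j
  ... | yes ≡.refl = just refl
  ... | no _       = nothing

  open import Algebra.Solver.Ring ℤ.+-*-rawRing (fromCommutativeRing R) morphism _≟-image_ public

module RowDifferences {c ℓ} (R : CommutativeRing c ℓ) where
  open CommutativeRing R
  open IntegerCoefficients R using (solve; _:+_; _:*_; _:-_; _:=_)

  cancel-rows : ∀ {L₁ R₁ L₂ R₂} Z → L₁ ≈ R₁ → L₂ ≈ R₂ → (L₁ - R₁) - (L₂ - R₂) + Z ≈ Z
  cancel-rows {R₁ = R₁} {R₂ = R₂} Z row₁ row₂ =
    trans (+-congʳ (+-cong (+-congʳ row₁) (-‿cong (+-congʳ row₂))))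
          (solve 3 (λ r₁ r₂ z → (r₁ :- r₁) :- (r₂ :- r₂) :+ z := z) refl R₁ R₂ Z)

  difference-of-rows₁ : ∀ {ρ σ a₁ a₂ w₁ w₂ C₁ C₂} →
    ρ * a₁ + C₁ ≈ σ * w₁ → ρ * a₂ + C₂ ≈ σ * w₂ →
    ρ * (a₁ - a₂) - σ * (w₁ - w₂) ≈ C₂ - C₁
  difference-of-rows₁ {ρ} {σ} {a₁} {a₂} {w₁} {w₂} {C₁} {C₂} row₁ row₂ =
    trans (solve 8 (λ ρ σ a₁ a₂ w₁ w₂ C₁ C₂ →
                      ρ :* (a₁ :- a₂) :- σ :* (w₁ :- w₂)
                   := ((ρ :* a₁ :+ C₁) :- σ :* w₁) :- ((ρ :* a₂ :+ C₂) :- σ :* w₂) :+ (C₂ :- C₁))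
                 refl ρ σ a₁ a₂ w₁ w₂ C₁ C₂)
          (cancel-rows (C₂ - C₁) row₁ row₂)

  difference-of-rows₂ : ∀ {ρ σ k b₁ b₂ w₁ w₂ C₁ C₂ T} →
    ρ * b₁ + T ≈ σ * w₁ + k * w₁ + C₁ → ρ * b₂ + T ≈ σ * w₂ + k * w₂ + C₂ →
    σ * (w₁ - w₂) - ρ * (b₁ - b₂) ≈ k * (w₂ - w₁) + (C₂ - C₁)
  difference-of-rows₂ {ρ} {σ} {k} {b₁} {b₂} {w₁} {w₂} {C₁} {C₂} {T} row₁ row₂ =
    trans (solve 10 (λ ρ σ k b₁ b₂ w₁ w₂ C₁ C₂ T →
                       σ :* (w₁ :- w₂) :- ρ :* (b₁ :- b₂)
                    := ((σ :* w₁ :+ k :* w₁ :+ C₁) :- (ρ :* b₁ :+ T))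
                       :- ((σ :* w₂ :+ k :* w₂ :+ C₂) :- (ρ :* b₂ :+ T))
                       :+ (k :* (w₂ :- w₁) :+ (C₂ :- C₁)))
                  refl ρ σ k b₁ b₂ w₁ w₂ C₁ C₂ T)
          (cancel-rows (k * (w₂ - w₁) + (C₂ - C₁)) (sym row₁) (sym row₂))

-- Finite sums

𝟙 : ∀ {p} {P : Set p} → Dec P → ℕ
𝟙 (yes _) = 1
𝟙 (no _)  = 0

𝟙-cong : ∀ {p q} {P : Set p} {Q : Set q} → (P → Q) → (Q → P) → (p? : Dec P) (q? : Dec Q) → 𝟙 p? ≡ 𝟙 q?
𝟙-cong P→Q Q→P (yes p) (yes q) = ≡.refl
𝟙-cong P→Q Q→P (yes p) (no ¬q) = ⊥-elim (¬q (P→Q p))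
𝟙-cong P→Q Q→P (no ¬p) (yes q) = ⊥-elim (¬p (Q→P q))
𝟙-cong P→Q Q→P (no ¬p) (no ¬q) = ≡.refl

module FiniteSums {c ℓ} (M : CommutativeMonoid c ℓ) where
  open CommutativeMonoid M renaming (ε to 0#; _∙_ to _+_; identityʳ to +-identityʳ; ∙-congˡ to +-congˡ)
  open MonoidSum M using (sum; sum-remove; sum-cong-≋; sum-replicate-zero)

  sum-supported-at : ∀ {n} (t : Fin n → Carrier) w → (∀ z → z ≢ w → t z ≈ 0#) → sum t ≈ t w
  sum-supported-at {suc n} t w vanishes = trans (sum-remove {i = w} t)
    (trans (+-congˡ (trans (sum-cong-≋ (λ k → vanishes _ (Fin.punchInᵢ≢i w k))) (sum-replicate-zero n)))
           (+-identityʳ (t w)))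

open MonoidSum ℕ.+-0-commutativeMonoid using () renaming (sum to ∑ℕ; sum-cong-≗ to ∑ℕ-cong; ∑-distrib-+ to ∑ℕ-distrib-+)
open FiniteSums ℕ.+-0-commutativeMonoid using () renaming (sum-supported-at to ∑ℕ-supported-at)

∑ℕ-point : ∀ {n} (w : Fin n) → ∑ℕ (λ z → 𝟙 (z Fin.≟ w)) ≡ 1
∑ℕ-point w = ≡.trans (∑ℕ-supported-at _ w off-w) (at-w (w Fin.≟ w))
  where
  off-w : ∀ z → z ≢ w → 𝟙 (z Fin.≟ w) ≡ 0
  off-w z z≢w with z Fin.≟ w
  ... | yes z≡w = ⊥-elim (z≢w z≡w)
  ... | no _    = ≡.refl
  at-w : (d : Dec (w ≡ w)) → 𝟙 d ≡ 1
  at-w (yes _)  = ≡.refl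
  at-w (no w≢w) = ⊥-elim (w≢w ≡.refl)

𝟙-there : ∀ {n b} (S : Subset n) z → 𝟙 (Fin.suc z ∈? (b ∷ S)) ≡ 𝟙 (z ∈? S)
𝟙-there S z with z ∈? S
... | yes _ = ≡.refl
... | no _  = ≡.refl

∑ℕ-subset : ∀ {n} (S : Subset n) → ∑ℕ (λ z → 𝟙 (z ∈? S)) ≡ ∣ S ∣
∑ℕ-subset []            = ≡.refl
∑ℕ-subset (inside ∷ S)  = ≡.cong suc (≡.trans (∑ℕ-cong (𝟙-there S)) (∑ℕ-subset S))
∑ℕ-subset (outside ∷ S) = ≡.trans (∑ℕ-cong (𝟙-there S)) (∑ℕ-subset S)

module OrderedFieldProperties {c ℓ₁ ℓ₂} (F : OrderedField c ℓ₁ ℓ₂) where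
  open OrderedField F
  open import Algebra.Properties.Ring ring using (-‿distribˡ-*; -‿involutive; -1*x≈-x)
  open import Algebra.Properties.Semiring.Sum semiring using (sum; sum-cong-≋; sum-cong-≗; ∑-distrib-+; *-distribʳ-sum)
  open FiniteSums +-commutativeMonoid using (sum-supported-at)
  open import Relation.Binary.Reasoning.Setoid setoid

  0≤-‿ : ∀ {a} → a ≤ᶠ 0# → 0# ≤ᶠ (- a)
  0≤-‿ {a} a≤0 = ≤ᶠ-resp-≈ (-‿inverseʳ a) (+-identityˡ (- a)) (+-mono-≤ᶠ (- a) a≤0)

  0≤1 : 0# ≤ᶠ 1#
  0≤1 with ≤ᶠ-total 0# 1#
  ... | inj₁ 0≤1 = 0≤1
  ... | inj₂ 1≤0 = ≤ᶠ-resp-≈ refl (trans (-1*x≈-x (- 1#)) (-‿involutive 1#)) (*-nonneg (0≤-‿ 1≤0) (0≤-‿ 1≤0))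

  +-nonneg : ∀ {a b} → 0# ≤ᶠ a → 0# ≤ᶠ b → 0# ≤ᶠ (a + b)
  +-nonneg {a} {b} 0≤a 0≤b = ≤ᶠ-trans (≤ᶠ-resp-≈ (+-identityˡ 0#) (+-identityʳ a) (+-mono-≤ᶠ 0# 0≤a))
                                      (≤ᶠ-resp-≈ (+-identityˡ a) (+-comm b a) (+-mono-≤ᶠ a 0≤b))

  fromℕ-nonneg : ∀ k → 0# ≤ᶠ (fromℕ k)
  fromℕ-nonneg zero    = ≤ᶠ-refl refl
  fromℕ-nonneg (suc k) = +-nonneg 0≤1 (fromℕ-nonneg k)

  sum-nonneg : ∀ {n} (t : Fin n → Carrier) → (∀ z → 0# ≤ᶠ (t z)) → 0# ≤ᶠ (sum t)
  sum-nonneg {zero}  t _   = ≤ᶠ-refl refl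
  sum-nonneg {suc n} t 0≤t = +-nonneg (0≤t Fin.zero) (sum-nonneg (t ∘ Fin.suc) (0≤t ∘ Fin.suc))

  nonneg⇒+1≉0 : ∀ {a} → 0# ≤ᶠ a → ¬ (a + 1# ≈ 0#)
  nonneg⇒+1≉0 0≤a a+1≈0 = 0≉1 (≤ᶠ-antisym 0≤1 (≤ᶠ-resp-≈ (+-identityˡ 1#) a+1≈0 (+-mono-≤ᶠ 1# 0≤a)))

  *-cancelˡ-≉0 : ∀ {k a b} → ¬ (k ≈ 0#) → k * a ≈ k * b → a ≈ b
  *-cancelˡ-≉0 {k} {a} {b} k≉0 ka≈kb with inverse k k≉0
  ... | k⁻¹ , kk⁻¹≈1 = begin
    a               ≈⟨ *-identityˡ a ⟨
    1# * a          ≈⟨ *-congʳ kk⁻¹≈1 ⟨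
    (k * k⁻¹) * a   ≈⟨ *-congʳ (*-comm k k⁻¹) ⟩
    (k⁻¹ * k) * a   ≈⟨ *-assoc k⁻¹ k a ⟩
    k⁻¹ * (k * a)   ≈⟨ *-congˡ ka≈kb ⟩
    k⁻¹ * (k * b)   ≈⟨ *-assoc k⁻¹ k b ⟨
    (k⁻¹ * k) * b   ≈⟨ *-congʳ (*-comm k⁻¹ k) ⟩
    (k * k⁻¹) * b   ≈⟨ *-congʳ kk⁻¹≈1 ⟩
    1# * b          ≈⟨ *-identityˡ b ⟩
    b               ∎

  nonneg-*-pos⇒nonneg : ∀ {a b} → 0# ≤ᶠ (a * b) → 0# <ᶠ b → 0# ≤ᶠ a
  nonneg-*-pos⇒nonneg {a} {b} 0≤ab (0≤b , 0≉b) with ≤ᶠ-total 0# a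
  ... | inj₁ 0≤a = 0≤a
  ... | inj₂ a≤0 = ≤ᶠ-refl (sym (*-cancelˡ-≉0 (λ b≈0 → 0≉b (sym b≈0)) b*a≈b*0))
    where
    ab≤0 : (a * b) ≤ᶠ 0#
    ab≤0 = ≤ᶠ-resp-≈ (+-identityˡ (a * b)) (-‿inverseˡ (a * b))
      (+-mono-≤ᶠ (a * b) (≤ᶠ-resp-≈ refl (sym (-‿distribˡ-* a b)) (*-nonneg (0≤-‿ a≤0) 0≤b)))
    b*a≈b*0 : b * a ≈ b * 0#
    b*a≈b*0 = trans (*-comm b a) (trans (sym (≤ᶠ-antisym 0≤ab ab≤0)) (sym (zeroʳ b)))

  fromℕ-+ : ∀ k l → fromℕ (k ℕ.+ l) ≈ fromℕ k + fromℕ l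
  fromℕ-+ zero    l = sym (+-identityˡ (fromℕ l))
  fromℕ-+ (suc k) l = trans (+-congˡ (fromℕ-+ k l)) (sym (+-assoc 1# (fromℕ k) (fromℕ l)))

  fromℕ-∑ : ∀ {n} (N : Fin n → ℕ) → fromℕ (∑ℕ N) ≈ sum (fromℕ ∘ N)
  fromℕ-∑ {zero}  N = refl
  fromℕ-∑ {suc n} N = trans (fromℕ-+ (N Fin.zero) _) (+-congˡ (fromℕ-∑ (N ∘ Fin.suc)))

  Σᶠ≡sum : ∀ {n} (t : Fin n → Carrier) → Σᶠ t ≡ sum t
  Σᶠ≡sum {n} t = ≡.trans (≡.cong (List.foldr _+_ 0#) (map-tabulate id t)) (foldr-tabulate t)
    where
    foldr-tabulate : ∀ {k} (s : Fin k → Carrier) → List.foldr _+_ 0# (List.tabulate s) ≡ sum s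
    foldr-tabulate {zero}  s = ≡.refl
    foldr-tabulate {suc k} s = ≡.cong (s Fin.zero +_) (foldr-tabulate (s ∘ Fin.suc))

  Σᶠ-cong : ∀ {n} {g h : Fin n → Carrier} → (∀ z → g z ≈ h z) → Σᶠ g ≈ Σᶠ h
  Σᶠ-cong {g = g} {h} g≈h = trans (reflexive (Σᶠ≡sum g)) (trans (sum-cong-≋ g≈h) (sym (reflexive (Σᶠ≡sum h))))

  fromℕ-1* : ∀ a → fromℕ 1 * a ≈ a
  fromℕ-1* a = trans (*-congʳ (+-identityʳ 1#)) (*-identityˡ a)

  weightedSum : ∀ {n} → (Fin n → ℕ) → (Fin n → Carrier) → Carrier
  weightedSum N y = sum (λ z → fromℕ (N z) * y z)

  -- The summand of Σ∈ uses a selector local to Defs, which cannot be named: the left-hand side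
  -- of selector≈weight is left to unification with its use in Σ∈≈weightedSum.
  mutual
    Σ∈≈weightedSum : ∀ {n} (S : Subset n) (y : Fin n → Carrier) → Σ∈ S y ≈ weightedSum (λ z → 𝟙 (z ∈? S)) y
    Σ∈≈weightedSum S y = trans (Σᶠ-cong (selector≈weight S y)) (reflexive (Σᶠ≡sum (λ z → fromℕ (𝟙 (z ∈? S)) * y z)))

    selector≈weight : ∀ {n} (S : Subset n) (y : Fin n → Carrier) z → _ ≈ fromℕ (𝟙 (z ∈? S)) * y z
    selector≈weight S y z with z ∈? S
    ... | yes _ = sym (fromℕ-1* _)
    ... | no _  = sym (zeroˡ _)

  module _ {n} (y : Fin n → Carrier) where

    weightedSum-cong : ∀ {N M : Fin n → ℕ} → N ≗ M → weightedSum N y ≈ weightedSum M y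
    weightedSum-cong N≗M = reflexive (sum-cong-≗ (λ z → ≡.cong (λ k → fromℕ k * y z) (N≗M z)))

    weightedSum-+ : ∀ (N M : Fin n → ℕ) → weightedSum (λ z → N z ℕ.+ M z) y ≈ weightedSum N y + weightedSum M y
    weightedSum-+ N M = trans (sum-cong-≋ (λ z → trans (*-congʳ (fromℕ-+ (N z) (M z))) (distribʳ (y z) _ _)))
                              (∑-distrib-+ (λ z → fromℕ (N z) * y z) (λ z → fromℕ (M z) * y z))

    weightedSum-point : ∀ w → weightedSum (λ z → 𝟙 (z Fin.≟ w)) y ≈ y w
    weightedSum-point w = trans (sum-supported-at _ w off-w) (at-w (w Fin.≟ w))
      where
      off-w : ∀ z → z ≢ w → fromℕ (𝟙 (z Fin.≟ w)) * y z ≈ 0#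
      off-w z z≢w with z Fin.≟ w
      ... | yes z≡w = ⊥-elim (z≢w z≡w)
      ... | no _    = zeroˡ (y z)
      at-w : (d : Dec (w ≡ w)) → fromℕ (𝟙 d) * y w ≈ y w
      at-w (yes _)  = fromℕ-1* (y w)
      at-w (no w≢w) = ⊥-elim (w≢w ≡.refl)

    weightedSum-ones : weightedSum (λ _ → 1) y ≈ Σᶠ y
    weightedSum-ones = trans (sum-cong-≋ (λ z → fromℕ-1* (y z))) (sym (reflexive (Σᶠ≡sum y)))

    weightedSum-constant-on-support : ∀ (N : Fin n → ℕ) {k} → (∀ z → N z ≢ 0 → y z ≈ k) →
      weightedSum N y ≈ fromℕ (∑ℕ N) * k
    weightedSum-constant-on-support N {k} constant = begin
      weightedSum N y              ≈⟨ sum-cong-≋ pointwise ⟩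
      sum (λ z → fromℕ (N z) * k)  ≈⟨ *-distribʳ-sum k (fromℕ ∘ N) ⟨
      sum (fromℕ ∘ N) * k          ≈⟨ *-congʳ (fromℕ-∑ N) ⟨
      fromℕ (∑ℕ N) * k             ∎
      where
      pointwise : ∀ z → fromℕ (N z) * y z ≈ fromℕ (N z) * k
      pointwise z with N z in Nz≡
      ... | zero  = trans (zeroˡ (y z)) (sym (zeroˡ k))
      ... | suc _ = *-congˡ (constant z (λ Nz≡0 → ℕ.1+n≢0 (≡.trans (≡.sym Nz≡) Nz≡0)))

  nonneg-eigenvalue : ∀ {n} (d : Fin n → Fin n → ℕ) {ρ x} → (∀ u → Spectral.mulD F d x u ≈ ρ * x u) →
    (∀ u → 0# <ᶠ x u) → Fin n → 0# ≤ᶠ ρ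
  nonneg-eigenvalue d {ρ} {x} eigen positive u = nonneg-*-pos⇒nonneg
    (≤ᶠ-resp-≈ refl (trans (reflexive (≡.sym (Σᶠ≡sum (λ z → fromℕ (d u z) * x z)))) (eigen u))
      (sum-nonneg _ (λ z → *-nonneg (fromℕ-nonneg (d u z)) (proj₁ (positive z)))))
    (positive u)

-- Walks and loose paths

lastSatisfying : (Q : ℕ → Set) → (∀ i → Dec (Q i)) → ∀ N → Q 0 →
  ∃[ j ] j ≤ N × Q j × (∀ i → j < i → i ≤ N → ¬ Q i)
lastSatisfying Q Q? zero q₀ = 0 , z≤n , q₀ , λ i 0<i i≤0 _ → ℕ.<-irrefl ≡.refl (ℕ.<-≤-trans 0<i i≤0)
lastSatisfying Q Q? (suc N) q₀ with Q? (suc N) | lastSatisfying Q Q? N q₀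
... | yes q | _ = suc N , ℕ.≤-refl , q , λ i N<i i≤N → ⊥-elim (ℕ.<-irrefl ≡.refl (ℕ.<-≤-trans N<i i≤N))
... | no ¬q | j , j≤N , qj , none = j , ℕ.m≤n⇒m≤1+n j≤N , qj , none′
  where
  none′ : ∀ i → j < i → i ≤ suc N → ¬ Q i
  none′ i j<i i≤1+N with ℕ.m≤n⇒m<n∨m≡n i≤1+N
  ... | inj₁ i<1+N = none i j<i (ℕ.≤-pred i<1+N)
  ... | inj₂ ≡.refl = ¬q

_[_≔_] : ∀ {X : Set} → (ℕ → X) → ℕ → X → ℕ → X
(f [ k ≔ x ]) i with i ℕ.≟ k
... | yes _ = x
... | no _  = f i

≔-here : ∀ {X : Set} (f : ℕ → X) k x → (f [ k ≔ x ]) k ≡ x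
≔-here f k x with k ℕ.≟ k
... | yes _  = ≡.refl
... | no k≢k = ⊥-elim (k≢k ≡.refl)

≔-elsewhere : ∀ {X : Set} (f : ℕ → X) {k} x {i} → i ≢ k → (f [ k ≔ x ]) i ≡ f i
≔-elsewhere f {k} x {i} i≢k with i ℕ.≟ k
... | yes i≡k = ⊥-elim (i≢k i≡k)
... | no _    = ≡.refl

module LoosePaths {n m : ℕ} (E : Fin m → Subset n) where
  open import Data.Nat using (_+_)
  open import Data.Nat.Properties
  open import Data.Unit using (tt)
  open ≡ using (refl; sym; trans; cong; subst; subst₂)

  Meets : Fin m → Fin m → Set
  Meets f g = ∃[ y ] y ∈ E f × y ∈ E g

  meets? : ∀ f g → Dec (Meets f g)
  meets? f g = Fin.any? (λ y → (y ∈? E f) ×-dec (y ∈? E g))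

  ¬meets⇒disjoint : ∀ {f g} → ¬ Meets f g → Disjoint (E f) (E g)
  ¬meets⇒disjoint ¬meet y y∈f y∈g = ¬meet (y , y∈f , y∈g)

  data Walk (A : Fin m → Set) : Fin n → Fin n → ℕ → Set where
    []   : ∀ {u} → Walk A u u 0
    step : ∀ {u v w p} (f : Fin m) → A f → u ∈ E f → v ∈ E f → Walk A v w p → Walk A u w (suc p)

  module _ {A : Fin m → Set} where

    _++ʷ_ : ∀ {u v w p q} → Walk A u v p → Walk A v w q → Walk A u w (p + q)
    []                ++ʷ W = W
    step f a u∈ v∈ V ++ʷ W = step f a u∈ v∈ (V ++ʷ W)

    reverseOnto : ∀ {u v w p q} → Walk A u v p → Walk A u w q → Walk A v w (p + q)
    reverseOnto []                       acc = acc
    reverseOnto {p = suc p} {q} (step f a u∈ v∈ W) acc =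
      subst (Walk A _ _) (+-suc p q) (reverseOnto W (step f a v∈ u∈ acc))

    reverseʷ : ∀ {u v p} → Walk A u v p → Walk A v u p
    reverseʷ {p = p} W = subst (Walk A _ _) (+-identityʳ p) (reverseOnto W [])

    -- LoosePathIn stores an edge sequence even for length 0, so the trivial path needs some edge.
    trivial : Fin m → ∀ {u} → LoosePathIn A E u u 0
    trivial e₀ {u} = record
      { v = λ _ → u ; e = λ _ → e₀ ; start = refl ; end = refl
      ; v-inj = λ { zero zero _ _ _ → refl ; zero (suc j) _ () _ ; (suc i) _ () _ _ }
      ; e-inj = λ _ _ () ; allowed = λ _ () ; incl₁ = λ _ () ; incl₂ = λ _ ()
      ; disjoint = λ _ _ () }

    reallow : ∀ {B : Fin m → Set} {u w p} (P : LoosePathIn A E u w p) →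
      (∀ i → i < p → B (LoosePathIn.e P i)) → LoosePathIn B E u w p
    reallow P okB = record
      { v = v ; e = e ; start = start ; end = end ; v-inj = v-inj ; e-inj = e-inj
      ; allowed = okB ; incl₁ = incl₁ ; incl₂ = incl₂ ; disjoint = disjoint }
      where open LoosePathIn P

    suffix : ∀ {u w p} (P : LoosePathIn A E u w p) k t → k + t ≡ p →
      ∀ {a} → LoosePathIn.v P k ≡ a → LoosePathIn A E a w t
    suffix {p = p} P k t k+t≡p vk≡a = record
      { v = λ i → v (k + i) ; e = λ i → e (k + i)
      ; start = trans (cong v (+-identityʳ k)) vk≡a
      ; end = trans (cong v k+t≡p) end
      ; v-inj = λ i j i≤t j≤t eq → +-cancelˡ-≡ k i j (v-inj (k + i) (k + j) (shift≤ i≤t) (shift≤ j≤t) eq)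
      ; e-inj = λ i j i<t j<t eq → +-cancelˡ-≡ k i j (e-inj (k + i) (k + j) (shift< i<t) (shift< j<t) eq)
      ; allowed = λ i i<t → allowed (k + i) (shift< i<t)
      ; incl₁ = λ i i<t → incl₁ (k + i) (shift< i<t)
      ; incl₂ = λ i i<t → subst (λ l → v l ∈ E (e (k + i))) (sym (+-suc k i)) (incl₂ (k + i) (shift< i<t))
      ; disjoint = λ i j i<t j<t 1+i<j → disjoint (k + i) (k + j) (shift< i<t) (shift< j<t)
          (subst (_< k + j) (+-suc k i) (+-monoʳ-< k 1+i<j))
      }
      where
      open LoosePathIn P
      shift≤ : ∀ {i} → i ≤ t → k + i ≤ p
      shift≤ i≤t = subst (_ ≤_) k+t≡p (+-monoʳ-≤ k i≤t)
      shift< : ∀ {i} → i < t → k + i < p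
      shift< i<t = subst (_ <_) k+t≡p (+-monoʳ-< k i<t)

    cons : ∀ {a w q} (P : LoosePathIn A E a w q) (g : Fin m) → A g → ∀ {u} → u ∈ E g → a ∈ E g →
      (∀ i → i ≤ q → LoosePathIn.v P i ≢ u) → (∀ i → i < q → LoosePathIn.e P i ≢ g) →
      (∀ i → 1 ≤ i → i < q → Disjoint (E g) (E (LoosePathIn.e P i))) →
      LoosePathIn A E u w (suc q)
    cons {q = q} P g Ag {u} u∈g a∈g fresh-v fresh-e far = record
      { v = v′ ; e = e′ ; start = refl ; end = end
      ; v-inj = v′-inj ; e-inj = e′-inj ; allowed = allowed′ ; incl₁ = incl₁′ ; incl₂ = incl₂′ ; disjoint = disjoint′ }
      where
      open LoosePathIn P
      v′ : ℕ → Fin n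
      v′ zero    = u
      v′ (suc i) = v i
      e′ : ℕ → Fin m
      e′ zero    = g
      e′ (suc i) = e i
      v′-inj : ∀ i j → i ≤ suc q → j ≤ suc q → v′ i ≡ v′ j → i ≡ j
      v′-inj zero    zero    _   _   _  = refl
      v′-inj zero    (suc j) _   j≤q eq = ⊥-elim (fresh-v j (≤-pred j≤q) (sym eq))
      v′-inj (suc i) zero    i≤q _   eq = ⊥-elim (fresh-v i (≤-pred i≤q) eq)
      v′-inj (suc i) (suc j) i≤q j≤q eq = cong suc (v-inj i j (≤-pred i≤q) (≤-pred j≤q) eq)
      e′-inj : ∀ i j → i < suc q → j < suc q → e′ i ≡ e′ j → i ≡ j
      e′-inj zero    zero    _   _   _  = refl
      e′-inj zero    (suc j) _   j<q eq = ⊥-elim (fresh-e j (≤-pred j<q) (sym eq))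
      e′-inj (suc i) zero    i<q _   eq = ⊥-elim (fresh-e i (≤-pred i<q) eq)
      e′-inj (suc i) (suc j) i<q j<q eq = cong suc (e-inj i j (≤-pred i<q) (≤-pred j<q) eq)
      allowed′ : ∀ i → i < suc q → A (e′ i)
      allowed′ zero    _   = Ag
      allowed′ (suc i) i<q = allowed i (≤-pred i<q)
      incl₁′ : ∀ i → i < suc q → v′ i ∈ E (e′ i)
      incl₁′ zero    _   = u∈g
      incl₁′ (suc i) i<q = incl₁ i (≤-pred i<q)
      incl₂′ : ∀ i → i < suc q → v′ (suc i) ∈ E (e′ i)
      incl₂′ zero    _   = subst (_∈ E g) (sym start) a∈g
      incl₂′ (suc i) i<q = incl₂ i (≤-pred i<q)
      disjoint′ : ∀ i j → i < suc q → j < suc q → suc i < j → Disjoint (E (e′ i)) (E (e′ j))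
      disjoint′ zero    (suc j) _   j<q (s≤s 1≤j) = far j 1≤j (≤-pred j<q)
      disjoint′ (suc i) (suc j) i<q j<q 1+i<j     = disjoint i j (≤-pred i<q) (≤-pred j<q) (≤-pred 1+i<j)

    segment : ∀ {B : Fin m → Set} {u w p} (P : LoosePathIn A E u w p) k t → k + t ≤ p →
      (∀ i → k ≤ i → i < k + t → B (LoosePathIn.e P i)) →
      Walk B (LoosePathIn.v P k) (LoosePathIn.v P (k + t)) t
    segment {B} P k zero    _       _ = subst (λ l → Walk B (LoosePathIn.v P k) (LoosePathIn.v P l) 0) (sym (+-identityʳ k)) []
    segment {B} {p = p} P k (suc t) k+t<p okB =
      step (e k) (okB k ≤-refl k<k+1+t) (incl₁ k k<p) (incl₂ k k<p)
        (subst (λ l → Walk B (v (suc k)) (v l) t) (sym (+-suc k t))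
          (segment P (suc k) t (subst (_≤ p) (+-suc k t) k+t<p)
            (λ i k<i i<k+t → okB i (<⇒≤ k<i) (subst (i <_) (sym (+-suc k t)) i<k+t))))
      where
      open LoosePathIn P
      k<k+1+t : k < k + suc t
      k<k+1+t = m<m+n k (s≤s z≤n)
      k<p : k < p
      k<p = <-≤-trans k<k+1+t k+t<p

    toWalk : ∀ {u w p} → LoosePathIn A E u w p → Walk A u w p
    toWalk {p = p} P = subst₂ (λ a b → Walk A a b p) start end
      (segment P 0 p ≤-refl (λ i _ i<p → allowed i i<p))
      where open LoosePathIn P

    -- j is the last edge of P meeting f: the part of P after e j is kept, and u is joined to it
    -- through f, through e j, or through both.
    module Reroute {v₀ w q₀} (P : LoosePathIn A E v₀ w (suc q₀)) (f : Fin m) (Af : A f)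
                   {u} (u∈f : u ∈ E f) (u∉P : ∀ i → i ≤ suc q₀ → LoosePathIn.v P i ≢ u)
                   (j : ℕ) (j≤q₀ : j ≤ q₀) (meetsⱼ : Meets f (LoosePathIn.e P j))
                   (later-miss-f : ∀ i → j < i → i ≤ q₀ → ¬ Meets f (LoosePathIn.e P i)) where
      open LoosePathIn P

      t : ℕ
      t = q₀ ∸ j

      j<1+q₀ : j < suc q₀
      j<1+q₀ = s≤s j≤q₀

      after≤ : ∀ {i} → i < t → suc (j + i) ≤ q₀
      after≤ {i} i<t = subst (_≤ q₀) (+-suc j i) (subst (j + suc i ≤_) (m+[n∸m]≡n j≤q₀) (+-monoʳ-≤ j i<t))

      rest : LoosePathIn A E (v (suc j)) w t
      rest = suffix P (suc j) t (cong suc (m+[n∸m]≡n j≤q₀)) refl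

      rest-misses-f : ∀ i → i < t → ¬ Meets f (e (suc (j + i)))
      rest-misses-f i i<t = later-miss-f (suc (j + i)) (s≤s (m≤m+n j i)) (after≤ i<t)

      rest-avoids-u : ∀ i → i ≤ t → LoosePathIn.v rest i ≢ u
      rest-avoids-u i i≤t = u∉P (suc (j + i)) (s≤s (subst (j + i ≤_) (m+[n∸m]≡n j≤q₀) (+-monoʳ-≤ j i≤t)))

      rest-avoids-f : ∀ i → i < t → LoosePathIn.e rest i ≢ f
      rest-avoids-f i i<t eᵢ≡f = rest-misses-f i i<t
        (_ , subst (λ g → _ ∈ E g) eᵢ≡f (incl₁ _ (s≤s (after≤ i<t))) , incl₁ _ (s≤s (after≤ i<t)))

      rest-far-from-f : ∀ i → 1 ≤ i → i < t → Disjoint (E f) (E (LoosePathIn.e rest i))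
      rest-far-from-f i _ i<t = ¬meets⇒disjoint (rest-misses-f i i<t)

      rest-avoids-eⱼ : ∀ i → i < t → LoosePathIn.e rest i ≢ e j
      rest-avoids-eⱼ i i<t eq = <-irrefl (sym (e-inj (suc (j + i)) j (s≤s (after≤ i<t)) j<1+q₀ eq)) (s≤s (m≤m+n j i))

      rest-far-from-eⱼ : ∀ i → 1 ≤ i → i < t → Disjoint (E (e j)) (E (LoosePathIn.e rest i))
      rest-far-from-eⱼ i 1≤i i<t = disjoint j (suc (j + i)) j<1+q₀ (s≤s (after≤ i<t))
        (s≤s (subst (_≤ j + i) (+-comm j 1) (+-monoʳ-≤ j 1≤i)))

      via-f : v (suc j) ∈ E f → LoosePathIn A E u w (suc t)
      via-f vⱼ₊₁∈f = cons rest f Af u∈f vⱼ₊₁∈f rest-avoids-u rest-avoids-f rest-far-from-f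

      via-eⱼ : u ∈ E (e j) → LoosePathIn A E u w (suc t)
      via-eⱼ u∈eⱼ = cons rest (e j) (allowed j j<1+q₀) u∈eⱼ (incl₂ j j<1+q₀)
        rest-avoids-u rest-avoids-eⱼ rest-far-from-eⱼ

      via-f-and-eⱼ : v (suc j) ∉ E f → u ∉ E (e j) → LoosePathIn A E u w (suc (suc t))
      via-f-and-eⱼ vⱼ₊₁∉f u∉eⱼ = cons inner f Af u∈f y∈f inner-avoids-u inner-avoids-f inner-far-from-f
        where
        y = proj₁ meetsⱼ
        y∈f = proj₁ (proj₂ meetsⱼ)
        y∈eⱼ = proj₂ (proj₂ meetsⱼ)
        rest-avoids-y : ∀ i → i ≤ t → LoosePathIn.v rest i ≢ y
        rest-avoids-y zero    _     v≡y =
          vⱼ₊₁∉f (subst (_∈ E f) (sym (trans (cong (λ l → v (suc l)) (sym (+-identityʳ j))) v≡y)) y∈f)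
        rest-avoids-y (suc i) 1+i≤t v≡y = rest-misses-f i 1+i≤t
          (y , y∈f , subst (_∈ E (e (suc (j + i)))) (trans (cong v (cong suc (sym (+-suc j i)))) v≡y)
                           (incl₂ _ (s≤s (after≤ 1+i≤t))))
        inner : LoosePathIn A E y w (suc t)
        inner = cons rest (e j) (allowed j j<1+q₀) y∈eⱼ (incl₂ j j<1+q₀) rest-avoids-y rest-avoids-eⱼ rest-far-from-eⱼ
        inner-avoids-u : ∀ i → i ≤ suc t → LoosePathIn.v inner i ≢ u
        inner-avoids-u zero    _     y≡u = u∉eⱼ (subst (_∈ E (e j)) y≡u y∈eⱼ)
        inner-avoids-u (suc i) 1+i≤t     = rest-avoids-u i (≤-pred 1+i≤t)
        inner-avoids-f : ∀ i → i < suc t → LoosePathIn.e inner i ≢ f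
        inner-avoids-f zero    _     eⱼ≡f = u∉eⱼ (subst (u ∈_) (cong E (sym eⱼ≡f)) u∈f)
        inner-avoids-f (suc i) 1+i<t      = rest-avoids-f i (≤-pred 1+i<t)
        inner-far-from-f : ∀ i → 1 ≤ i → i < suc t → Disjoint (E f) (E (LoosePathIn.e inner i))
        inner-far-from-f (suc i) _ 1+i<t = ¬meets⇒disjoint (rest-misses-f i (≤-pred 1+i<t))

      shortcut : ∃[ q ] q ≤ suc (suc q₀) × LoosePathIn A E u w q
      shortcut with v (suc j) ∈? E f | u ∈? E (e j)
      ... | yes vⱼ₊₁∈f | _       = suc t , s≤s (≤-trans (m∸n≤m q₀ j) (n≤1+n q₀)) , via-f vⱼ₊₁∈f
      ... | no _       | yes u∈eⱼ = suc t , s≤s (≤-trans (m∸n≤m q₀ j) (n≤1+n q₀)) , via-eⱼ u∈eⱼ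
      ... | no vⱼ₊₁∉f  | no u∉eⱼ  = suc (suc t) , s≤s (s≤s (m∸n≤m q₀ j)) , via-f-and-eⱼ vⱼ₊₁∉f u∉eⱼ

    prepend-fresh : ∀ {v₀ w q} (P : LoosePathIn A E v₀ w q) (f : Fin m) → A f → ∀ {u} → u ∈ E f → v₀ ∈ E f →
      (∀ i → i ≤ q → LoosePathIn.v P i ≢ u) → ∃[ q′ ] q′ ≤ suc q × LoosePathIn A E u w q′
    prepend-fresh {q = zero} P f Af u∈f v₀∈f u∉P = 1 , ≤-refl , cons P f Af u∈f v₀∈f u∉P (λ _ ()) (λ _ _ ())
    prepend-fresh {v₀} {q = suc q₀} P f Af u∈f v₀∈f u∉P
      with lastSatisfying (λ i → Meets f (LoosePathIn.e P i)) (λ i → meets? f (LoosePathIn.e P i)) q₀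
             (v₀ , v₀∈f , subst (_∈ E (LoosePathIn.e P 0)) (LoosePathIn.start P) (LoosePathIn.incl₁ P 0 (s≤s z≤n)))
    ... | j , j≤q₀ , meetsⱼ , later-miss-f = Reroute.shortcut P f Af u∈f u∉P j j≤q₀ meetsⱼ later-miss-f

    prepend : ∀ {v₀ w q} (P : LoosePathIn A E v₀ w q) (f : Fin m) → A f → ∀ {u} → u ∈ E f → v₀ ∈ E f →
      ∃[ q′ ] q′ ≤ suc q × LoosePathIn A E u w q′
    prepend {q = q} P f Af {u} u∈f v₀∈f with anyUpTo? (λ l → LoosePathIn.v P l Fin.≟ u) (suc q)
    ... | yes (l , l<1+q , vₗ≡u) =
      q ∸ l , ≤-trans (m∸n≤m q l) (n≤1+n q) , suffix P l (q ∸ l) (m+[n∸m]≡n (≤-pred l<1+q)) vₗ≡u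
    ... | no u∉P = prepend-fresh P f Af u∈f v₀∈f (λ i i≤q vᵢ≡u → u∉P (i , s≤s i≤q , vᵢ≡u))

    walk-to-edge : ∀ {u w p} (P : LoosePathIn A E u w p) {i y} → i < p → y ∈ E (LoosePathIn.e P i) → Walk A u y (suc i)
    walk-to-edge P {i} {y} i<p y∈eᵢ = subst₂ (λ x l → Walk A x y l) start (+-comm i 1)
      (segment P 0 i (<⇒≤ i<p) (λ k _ k<i → allowed k (<-trans k<i i<p))
        ++ʷ step (e i) (allowed i i<p) (incl₁ i i<p) y∈eᵢ [])
      where open LoosePathIn P

    walk-from-edge : ∀ {u w p} (P : LoosePathIn A E u w p) {i y} → i < p → y ∈ E (LoosePathIn.e P i) →
      Walk A y w (suc (p ∸ suc i))
    walk-from-edge {p = p} P {i} i<p y∈eᵢ = step (e i) (allowed i i<p) y∈eᵢ (incl₂ i i<p)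
      (subst (λ x → Walk A (v (suc i)) x (p ∸ suc i)) (trans (cong v (m+[n∸m]≡n i<p)) end)
        (segment P (suc i) (p ∸ suc i) (≤-reflexive (m+[n∸m]≡n i<p))
          (λ k _ k<p → allowed k (subst (k <_) (m+[n∸m]≡n i<p) k<p))))
      where open LoosePathIn P

    walk⇒loosePath : Fin m → ∀ {u w p} → Walk A u w p → ∃[ q ] q ≤ p × LoosePathIn A E u w q
    walk⇒loosePath e₀ []                   = 0 , z≤n , trivial e₀
    walk⇒loosePath e₀ (step f Af u∈f v∈f W) with walk⇒loosePath e₀ W
    ... | q , q≤p , P with prepend P f Af u∈f v∈f
    ...   | q′ , q′≤1+q , P′ = q′ , ≤-trans q′≤1+q (s≤s q≤p) , P′

  Avoiding : Fin m → Fin m → Set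
  Avoiding e f = f ≢ e

  closeWith : ∀ f {a b p} → 1 ≤ p → a ∈ E f → b ∈ E f → (P : LoosePathIn (Avoiding f) E a b p) →
    (∀ i → 1 ≤ i → suc (suc i) ≤ p → Disjoint (E (LoosePathIn.e P i)) (E f)) → LooseCycle E (suc p)
  closeWith f {a} {b} {p} 1≤p a∈f b∈f P inner-far = record
    { two≤p = s≤s 1≤p ; v = v′ ; e = e′ ; closed = trans (≔-here v (suc p) (v 0)) (sym (≔-elsewhere v {suc p} (v 0) λ ()))
    ; v-inj = v′-inj ; e-inj = e′-inj ; incl₁ = incl₁′ ; incl₂ = incl₂′ ; disjoint = disjoint′ }
    where
    open LoosePathIn P
    v′ = v [ suc p ≔ v 0 ]
    e′ = e [ p ≔ f ]
    v′≡v : ∀ {k} → k < suc p → v′ k ≡ v k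
    v′≡v k<1+p = ≔-elsewhere v _ (<⇒≢ k<1+p)
    e′≡e : ∀ {k} → k < p → e′ k ≡ e k
    e′≡e k<p = ≔-elsewhere e _ (<⇒≢ k<p)
    last-or-before : ∀ {k} → k < suc p → k < p ⊎ k ≡ p
    last-or-before k<1+p = m≤n⇒m<n∨m≡n (≤-pred k<1+p)
    v′-inj : ∀ i j → i < suc p → j < suc p → v′ i ≡ v′ j → i ≡ j
    v′-inj i j i<1+p j<1+p eq = v-inj i j (≤-pred i<1+p) (≤-pred j<1+p)
      (trans (sym (v′≡v i<1+p)) (trans eq (v′≡v j<1+p)))
    e′-inj : ∀ i j → i < suc p → j < suc p → e′ i ≡ e′ j → i ≡ j
    e′-inj i j i<1+p j<1+p eq with last-or-before i<1+p | last-or-before j<1+p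
    ... | inj₂ refl | inj₂ refl = refl
    ... | inj₁ i<p  | inj₁ j<p  = e-inj i j i<p j<p (trans (sym (e′≡e i<p)) (trans eq (e′≡e j<p)))
    ... | inj₁ i<p  | inj₂ refl = ⊥-elim (allowed i i<p (trans (sym (e′≡e i<p)) (trans eq (≔-here e p f))))
    ... | inj₂ refl | inj₁ j<p  = ⊥-elim (allowed j j<p (trans (sym (e′≡e j<p)) (trans (sym eq) (≔-here e p f))))
    incl₁′ : ∀ i → i < suc p → v′ i ∈ E (e′ i)
    incl₁′ i i<1+p with last-or-before i<1+p
    ... | inj₁ i<p  = subst₂ (λ x g → x ∈ E g) (sym (v′≡v i<1+p)) (sym (e′≡e i<p)) (incl₁ i i<p)
    ... | inj₂ refl = subst₂ (λ x g → x ∈ E g) (sym (trans (v′≡v i<1+p) end)) (sym (≔-here e p f)) b∈f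
    incl₂′ : ∀ i → i < suc p → v′ (suc i) ∈ E (e′ i)
    incl₂′ i i<1+p with last-or-before i<1+p
    ... | inj₁ i<p  = subst₂ (λ x g → x ∈ E g) (sym (v′≡v (s≤s i<p))) (sym (e′≡e i<p)) (incl₂ i i<p)
    ... | inj₂ refl = subst₂ (λ x g → x ∈ E g) (sym (trans (≔-here v (suc p) (v 0)) start)) (sym (≔-here e p f)) a∈f
    disjoint′ : ∀ i j → i < suc p → j < suc p → suc i < j → ¬ (i ≡ 0 × suc j ≡ suc p) → Disjoint (E (e′ i)) (E (e′ j))
    disjoint′ i j i<1+p j<1+p 1+i<j not-ends with last-or-before j<1+p
    ... | inj₁ j<p  = subst₂ (λ g h → Disjoint (E g) (E h)) (sym (e′≡e i<p)) (sym (e′≡e j<p)) (disjoint i j i<p j<p 1+i<j)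
      where
      i<p : i < p
      i<p = <-trans (n<1+n i) (<-trans 1+i<j j<p)
    ... | inj₂ refl = subst₂ (λ g h → Disjoint (E g) (E h)) (sym (e′≡e i<p)) (sym (≔-here e p f))
                        (inner-far i (1≤i i not-ends) 1+i<j)
      where
      i<p : i < p
      i<p = <-trans (n<1+n i) 1+i<j
      1≤i : ∀ k → ¬ (k ≡ 0 × suc p ≡ suc p) → 1 ≤ k
      1≤i zero    not-first = ⊥-elim (not-first (refl , refl))
      1≤i (suc k) _         = s≤s z≤n

  Reach : Fin m → Fin n → Fin n → Set
  Reach e y z = ∃[ p ] LoosePathIn (Avoiding e) E y z p

  reach-refl : ∀ e z → Reach e z z
  reach-refl e z = 0 , trivial e

  reach-from-pendant : ∀ e {w z} → (∀ j → w ∈ E j → j ≡ e) → Reach e w z → z ≡ w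
  reach-from-pendant e only-e (zero , P) = trans (sym (LoosePathIn.end P)) (LoosePathIn.start P)
  reach-from-pendant e only-e (suc p , P) =
    ⊥-elim (P.allowed 0 (s≤s z≤n) (only-e (P.e 0) (subst (_∈ E (P.e 0)) P.start (P.incl₁ 0 (s≤s z≤n)))))
    where module P = LoosePathIn P

  last-exit : ∀ e {B : Fin m → Set} {a z p} (P : LoosePathIn B E a z p) → a ∈ E e →
    ∃[ k ] k ≤ p × LoosePathIn.v P k ∈ E e × LoosePathIn (Avoiding e) E (LoosePathIn.v P k) z (p ∸ k)
  last-exit e {p = p} P a∈e with lastSatisfying (λ i → LoosePathIn.v P i ∈ E e) (λ i → LoosePathIn.v P i ∈? E e) p
                                (subst (_∈ E e) (sym (LoosePathIn.start P)) a∈e)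
  ... | k , k≤p , vₖ∈e , later-outside =
    k , k≤p , vₖ∈e , reallow (suffix P k (p ∸ k) (m+[n∸m]≡n k≤p) refl) avoids
    where
    module P = LoosePathIn P
    avoids : ∀ i → i < p ∸ k → P.e (k + i) ≢ e
    avoids i i<p∸k eₖ₊ᵢ≡e = later-outside (suc (k + i)) (s≤s (m≤m+n k i)) k+i<p
      (subst (λ g → P.v (suc (k + i)) ∈ E g) eₖ₊ᵢ≡e (P.incl₂ (k + i) k+i<p))
      where
      k+i<p : k + i < p
      k+i<p = subst (k + i <_) (m+[n∸m]≡n k≤p) (+-monoʳ-< k i<p∸k)

  attachment : Connected E → ∀ e {a} → a ∈ E e → ∀ z → ∃[ t ] t ∈ E e × Reach e t z
  attachment connected e a∈e z with connected _ z
  ... | _ , P with last-exit e P a∈e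
  ...   | k , _ , vₖ∈e , Q = LoosePathIn.v P k , vₖ∈e , _ , Q

  module Distance (d : Fin n → Fin n → ℕ) (isD : IsDistance E d) where

    shortest : ∀ u w → LoosePath E u w (d u w)
    shortest u w = proj₁ (isD u w)

    d-minimal : ∀ {B : Fin m → Set} {u w p} → LoosePathIn B E u w p → d u w ≤ p
    d-minimal {u = u} {w} {p} P = proj₂ (isD u w) p (reallow P (λ _ _ → tt))

    d-walk : ∀ f {B : Fin m → Set} {u w p} → Walk B u w p → d u w ≤ p
    d-walk f W with walk⇒loosePath f W
    ... | _ , q≤p , P = ≤-trans (d-minimal P) q≤p

    d-stepˡ : ∀ f {u u′ w} → u ∈ E f → u′ ∈ E f → d u w ≤ suc (d u′ w)
    d-stepˡ f u∈f u′∈f = d-walk f (step f tt u∈f u′∈f (toWalk (shortest _ _)))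

    d-stepʳ : ∀ f {u w w′} → w ∈ E f → w′ ∈ E f → d u w ≤ suc (d u w′)
    d-stepʳ f {u} {w} {w′} w∈f w′∈f =
      subst (d u w ≤_) (+-comm (d u w′) 1) (d-walk f (toWalk (shortest u w′) ++ʷ step f tt w′∈f w∈f []))

  module Acyclic (acyclic : ∀ p → ¬ LooseCycle E p) where

    -- By induction on the length: an inner edge meeting e at y gives a shorter such path, from a to y
    -- or from y = a to b; if there is none, the path closes up with e into a loose cycle.
    no-avoiding-path : ∀ e {a b p} → a ≢ b → a ∈ E e → b ∈ E e → ¬ LoosePathIn (Avoiding e) E a b p
    no-avoiding-path e {p = p} = bounded p ≤-refl
      where
      shorter : ∀ N {p₀ a b l} → p₀ ≤ N → Walk (Avoiding e) a b l → l ≤ p₀ → a ≢ b → a ∈ E e → b ∈ E e → ⊥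
      bounded : ∀ N {a b p} → p ≤ N → a ≢ b → a ∈ E e → b ∈ E e → ¬ LoosePathIn (Avoiding e) E a b p
      bounded N       {p = zero}   _          a≢b _   _   P = a≢b (trans (sym (LoosePathIn.start P)) (LoosePathIn.end P))
      bounded (suc N) {a} {b} {suc p₀} (s≤s p₀≤N) a≢b a∈e b∈e P
        with anyUpTo? (λ i → (1 ≤? i) ×-dec ((suc (suc i) ≤? suc p₀) ×-dec meets? (LoosePathIn.e P i) e)) (suc p₀)
      ... | no none = acyclic _ (closeWith e (s≤s z≤n) a∈e b∈e P inner-far)
        where
        inner-far : ∀ i → 1 ≤ i → suc (suc i) ≤ suc p₀ → Disjoint (E (LoosePathIn.e P i)) (E e)
        inner-far i 1≤i 2+i≤p = ¬meets⇒disjoint λ meet → none (i , <-trans (n<1+n i) 2+i≤p , 1≤i , 2+i≤p , meet)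
      ... | yes (i , _ , 1≤i , s≤s 1+i≤p₀ , y , y∈eᵢ , y∈e) with y Fin.≟ a
      ...   | yes refl = shorter N p₀≤N (walk-from-edge P (<-trans (n<1+n i) (s≤s 1+i≤p₀)) y∈eᵢ)
                           (∸-monoʳ-< 1≤i (<⇒≤ 1+i≤p₀)) a≢b a∈e b∈e
      ...   | no y≢a   = shorter N p₀≤N (walk-to-edge P (<-trans (n<1+n i) (s≤s 1+i≤p₀)) y∈eᵢ)
                           1+i≤p₀ (λ a≡y → y≢a (sym a≡y)) a∈e y∈e

      shorter N p₀≤N W l≤p₀ a≢b a∈e b∈e with walk⇒loosePath e W
      ... | q , q≤l , Q = bounded N (≤-trans q≤l (≤-trans l≤p₀ p₀≤N)) a≢b a∈e b∈e Q

    reach-unique : ∀ e {y y′ z} → y ∈ E e → y′ ∈ E e → Reach e y z → Reach e y′ z → y ≡ y′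
    reach-unique e {y} {y′} y∈e y′∈e (_ , P) (_ , P′) with y Fin.≟ y′
    ... | yes y≡y′ = y≡y′
    ... | no y≢y′ with walk⇒loosePath e (toWalk P ++ʷ reverseʷ (toWalk P′))
    ...   | _ , _ , Q = ⊥-elim (no-avoiding-path e y≢y′ y∈e y′∈e Q)

    module _ (d : Fin n → Fin n → ℕ) (isD : IsDistance E d) where
      open Distance d isD

      reach-distance : ∀ e {t y z} → t ∈ E e → y ∈ E e → y ≢ t → Reach e t z → d y z ≡ suc (d t z)
      reach-distance e {t} {y} {z} t∈e y∈e y≢t reach = ≤-antisym (d-stepˡ e y∈e t∈e) lower
        where
        P = shortest y z
        lower : suc (d t z) ≤ d y z
        lower with last-exit e P y∈e
        ... | k , k≤p , vₖ∈e , Q = subst (suc (d t z) ≤_) (m+[n∸m]≡n k≤p)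
          (≤-trans (s≤s (subst (λ x → d x z ≤ d y z ∸ k) vₖ≡t (d-minimal Q))) (+-monoˡ-≤ _ 1≤k))
          where
          vₖ≡t : LoosePathIn.v P k ≡ t
          vₖ≡t = reach-unique e vₖ∈e t∈e (_ , Q) reach
          1≤k : 1 ≤ k
          1≤k = n≢0⇒n>0 λ k≡0 → y≢t (trans (sym (LoosePathIn.start P)) (trans (cong (LoosePathIn.v P) (sym k≡0)) vₖ≡t))

length-filter-∷ : ∀ {A : Set} {P : Pred A 0ℓ} (P? : Decidable P) x xs →
  length (filter P? xs) ≤ length (filter P? (x ∷ xs))
length-filter-∷ P? x xs with does (P? x)
... | true  = ℕ.n≤1+n _
... | false = ℕ.≤-refl

two-members⇒2≤length-filter : ∀ {A : Set} {P : Pred A 0ℓ} (P? : Decidable P) xs {a b} →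
  a ∈ˡ xs → b ∈ˡ xs → a ≢ b → P a → P b → 2 ≤ length (filter P? xs)
two-members⇒2≤length-filter P? (x ∷ xs) (here ≡.refl) (here ≡.refl) a≢b _ _ = ⊥-elim (a≢b ≡.refl)
two-members⇒2≤length-filter {P = P} P? (x ∷ xs) (here ≡.refl) (there b∈xs) _ Pa Pb =
  ≡.subst (λ l → 2 ≤ length l) (≡.sym (filter-accept P? Pa))
    (s≤s (filter-some P? (Any.map (λ b≡y → ≡.subst P b≡y Pb) b∈xs)))
two-members⇒2≤length-filter {P = P} P? (x ∷ xs) (there a∈xs) (here ≡.refl) _ Pa Pb =
  ≡.subst (λ l → 2 ≤ length l) (≡.sym (filter-accept P? Pb))
    (s≤s (filter-some P? (Any.map (λ a≡y → ≡.subst P a≡y Pa) a∈xs)))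
two-members⇒2≤length-filter P? (x ∷ xs) (there a∈xs) (there b∈xs) a≢b Pa Pb =
  ℕ.≤-trans (two-members⇒2≤length-filter P? xs a∈xs b∈xs a≢b Pa Pb) (length-filter-∷ P? x xs)

degree≡1⇒unique-edge : ∀ {n m} (E : Fin m → Subset n) {w e} → degree E w ≡ 1 → w ∈ E e → ∀ j → w ∈ E j → j ≡ e
degree≡1⇒unique-edge {m = m} E {w} {e} deg≡1 w∈e j w∈j with j Fin.≟ e
... | yes j≡e = j≡e
... | no j≢e  = ⊥-elim (ℕ.1+n≰n (≡.subst (2 ≤_) deg≡1
  (two-members⇒2≤length-filter (λ k → w ∈? E k) (allFin m) (∈-allFin j) (∈-allFin e) j≢e w∈j w∈e)))

-- A cut edge with pendant vertices

module CutEdge {n m} (E : Fin m → Subset n) (connected : Connected E) (acyclic : ∀ p → ¬ LooseCycle E p)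
               (e : Fin m) {a b} (a∈e : a ∈ E e) (b∈e : b ∈ E e) (a≢b : a ≢ b)
               (pendant-degree : ∀ z → z ∈ E e → z ≢ a → z ≢ b → degree E z ≡ 1) where
  open LoosePaths E
  open Acyclic acyclic

  anchor : Fin n → Fin n
  anchor z = proj₁ (attachment connected e a∈e z)

  anchor-∈ : ∀ z → anchor z ∈ E e
  anchor-∈ z = proj₁ (proj₂ (attachment connected e a∈e z))

  anchor-reaches : ∀ z → Reach e (anchor z) z
  anchor-reaches z = proj₂ (proj₂ (attachment connected e a∈e z))

  anchor-unique : ∀ {t z} → t ∈ E e → Reach e t z → t ≡ anchor z
  anchor-unique {z = z} t∈e t↝z = reach-unique e t∈e (anchor-∈ z) t↝z (anchor-reaches z)

  anchoredAt : Fin n → Fin n → ℕ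
  anchoredAt y z = 𝟙 (anchor z Fin.≟ y)

  IsPendant : Fin n → Set
  IsPendant z = z ∈ E e × z ≢ a × z ≢ b

  pendant? : ∀ z → Dec (IsPendant z)
  pendant? z = (z ∈? E e) ×-dec (¬? (z Fin.≟ a) ×-dec ¬? (z Fin.≟ b))

  pendant-in-e-only : ∀ {w} → IsPendant w → ∀ j → w ∈ E j → j ≡ e
  pendant-in-e-only (w∈e , w≢a , w≢b) = degree≡1⇒unique-edge E (pendant-degree _ w∈e w≢a w≢b) w∈e

  anchor-of-member : ∀ {z} → z ∈ E e → z ≡ anchor z
  anchor-of-member z∈e = anchor-unique z∈e (reach-refl e _)

  anchor-of-pendant : ∀ {z} → IsPendant (anchor z) → z ≡ anchor z
  anchor-of-pendant {z} pendant = reach-from-pendant e (pendant-in-e-only pendant) (anchor-reaches z)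

  module _ (d : Fin n → Fin n → ℕ) (isD : IsDistance E d) where

    distance-profile : ∀ {y} z → y ∈ E e → d y z +ℕ anchoredAt y z ≡ suc (d (anchor z) z)
    distance-profile {y} z y∈e with anchor z Fin.≟ y
    ... | yes ≡.refl = ℕ.+-comm (d (anchor z) z) 1
    ... | no t≢y     = ≡.trans (ℕ.+-identityʳ _)
                         (reach-distance d isD e (anchor-∈ z) y∈e (λ y≡t → t≢y (≡.sym y≡t)) (anchor-reaches z))

  component-indicator : ∀ {C} → IsComponentMinus E e a C → ∀ z → 𝟙 (z ∈? C) ≡ anchoredAt a z
  component-indicator component z = 𝟙-cong
    (λ z∈C → ≡.sym (anchor-unique a∈e (proj₁ (component z) z∈C)))
    (λ t≡a → proj₂ (component z) (≡.subst (λ t → Reach e t z) t≡a (anchor-reaches z)))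
    (z ∈? _) (anchor z Fin.≟ a)

  pendant-indicator : ∀ {w} → IsPendant w → ∀ z → 𝟙 (z Fin.≟ w) ≡ anchoredAt w z
  pendant-indicator {w} w-pendant z = 𝟙-cong
    (λ { ≡.refl → ≡.sym (anchor-of-member (proj₁ w-pendant)) })
    (λ t≡w → ≡.trans (anchor-of-pendant (≡.subst IsPendant (≡.sym t≡w) w-pendant)) t≡w)
    (z Fin.≟ w) (anchor z Fin.≟ w)

  pendant⇔anchor-pendant : ∀ z → 𝟙 (pendant? z) ≡ 𝟙 (pendant? (anchor z))
  pendant⇔anchor-pendant z = 𝟙-cong
    (λ z-pendant → ≡.subst IsPendant (anchor-of-member (proj₁ z-pendant)) z-pendant)
    (λ t-pendant → ≡.subst IsPendant (≡.sym (anchor-of-pendant t-pendant)) t-pendant)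
    (pendant? z) (pendant? (anchor z))

  edge-partition : ∀ y → 𝟙 (pendant? y) +ℕ 𝟙 (y Fin.≟ a) +ℕ 𝟙 (y Fin.≟ b) ≡ 𝟙 (y ∈? E e)
  edge-partition y with y ∈? E e | y Fin.≟ a | y Fin.≟ b
  ... | yes _   | yes ≡.refl | yes ≡.refl = ⊥-elim (a≢b ≡.refl)
  ... | yes _   | yes ≡.refl | no _     = ≡.refl
  ... | yes _   | no _     | yes ≡.refl = ≡.refl
  ... | yes _   | no _     | no _     = ≡.refl
  ... | no y∉e  | yes ≡.refl | _        = ⊥-elim (y∉e a∈e)
  ... | no y∉e  | no _     | yes ≡.refl = ⊥-elim (y∉e b∈e)
  ... | no _    | no _     | no _     = ≡.refl

  anchor-partition : ∀ z → 𝟙 (pendant? z) +ℕ anchoredAt a z +ℕ anchoredAt b z ≡ 1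
  anchor-partition z = ≡.trans (≡.cong (λ k → k +ℕ anchoredAt a z +ℕ anchoredAt b z) (pendant⇔anchor-pendant z))
    (≡.trans (edge-partition (anchor z)) (in-e (anchor z ∈? E e)))
    where
    in-e : (d : Dec (anchor z ∈ E e)) → 𝟙 d ≡ 1
    in-e (yes _)  = ≡.refl
    in-e (no t∉e) = ⊥-elim (t∉e (anchor-∈ z))

  pendant-count : ∀ {r} → ∣ E e ∣ ≡ r → ∑ℕ (𝟙 ∘ pendant?) ≡ r ∸ 2
  pendant-count {r} ∣e∣≡r = ≡.trans (≡.sym (ℕ.m+n∸n≡m S 2)) (≡.cong (_∸ 2) S+2≡r)
    where
    open ≡-Reasoning
    S : ℕ
    S = ∑ℕ (𝟙 ∘ pendant?)
    Iₐ I_b : Fin n → ℕ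
    Iₐ y = 𝟙 (y Fin.≟ a)
    I_b y = 𝟙 (y Fin.≟ b)
    S+2≡r : S +ℕ 2 ≡ r
    S+2≡r = begin
      S +ℕ 2                                         ≡⟨ ℕ.+-assoc S 1 1 ⟨
      S +ℕ 1 +ℕ 1                                    ≡⟨ ≡.cong₂ (λ k l → S +ℕ k +ℕ l) (∑ℕ-point a) (∑ℕ-point b) ⟨
      S +ℕ ∑ℕ Iₐ +ℕ ∑ℕ I_b                           ≡⟨ ≡.cong (_+ℕ ∑ℕ I_b) (∑ℕ-distrib-+ (𝟙 ∘ pendant?) Iₐ) ⟨
      ∑ℕ (λ y → 𝟙 (pendant? y) +ℕ Iₐ y) +ℕ ∑ℕ I_b    ≡⟨ ∑ℕ-distrib-+ (λ y → 𝟙 (pendant? y) +ℕ Iₐ y) I_b ⟨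
      ∑ℕ (λ y → 𝟙 (pendant? y) +ℕ Iₐ y +ℕ I_b y)     ≡⟨ ∑ℕ-cong edge-partition ⟩
      ∑ℕ (λ y → 𝟙 (y ∈? E e))                        ≡⟨ ∑ℕ-subset (E e) ⟩
      ∣ E e ∣                                        ≡⟨ ∣e∣≡r ⟩
      r                                              ∎

  module Rows {c ℓ₁ ℓ₂} (F : OrderedField c ℓ₁ ℓ₂) (d : Fin n → Fin n → ℕ) (isD : IsDistance E d) where
    open OrderedField F
    open OrderedFieldProperties F
    open IntegerCoefficients commRing using (solve; _:+_; _:=_)
    open import Relation.Binary.Reasoning.Setoid setoid

    module Eigenvector (ρ : Carrier) (x : Fin n → Carrier) (eigen : ∀ u → Spectral.mulD F d x u ≈ ρ * x u) where

      mass : (Fin n → ℕ) → Carrier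
      mass N = weightedSum N x

      eigen-row : ∀ u → mass (d u) ≈ ρ * x u
      eigen-row u = trans (reflexive (≡.sym (Σᶠ≡sum (λ w → fromℕ (d u w) * x w)))) (eigen u)

      τ : Carrier
      τ = mass (λ z → suc (d (anchor z) z))

      edge-row : ∀ {y} → y ∈ E e → ρ * x y + mass (anchoredAt y) ≈ τ
      edge-row {y} y∈e = begin
        ρ * x y + mass (anchoredAt y)              ≈⟨ +-congʳ (eigen-row y) ⟨
        mass (d y) + mass (anchoredAt y)           ≈⟨ weightedSum-+ x (d y) (anchoredAt y) ⟨
        mass (λ z → d y z +ℕ anchoredAt y z)       ≈⟨ weightedSum-cong x (λ z → distance-profile d isD z y∈e) ⟩
        τ                                          ∎

      pendant-row : ∀ {w} → IsPendant w → (ρ + 1#) * x w ≈ τ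
      pendant-row {w} w-pendant = begin
        (ρ + 1#) * x w                        ≈⟨ distribʳ (x w) ρ 1# ⟩
        ρ * x w + 1# * x w                    ≈⟨ +-congˡ (*-identityˡ (x w)) ⟩
        ρ * x w + x w                         ≈⟨ +-congˡ (weightedSum-point x w) ⟨
        ρ * x w + mass (λ z → 𝟙 (z Fin.≟ w))  ≈⟨ +-congˡ (weightedSum-cong x (pendant-indicator w-pendant)) ⟩
        ρ * x w + mass (anchoredAt w)         ≈⟨ edge-row (proj₁ w-pendant) ⟩
        τ                                     ∎

      component-mass : ∀ {C} → IsComponentMinus E e a C → Σ∈ C x ≈ mass (anchoredAt a)
      component-mass {C} component = trans (Σ∈≈weightedSum C x) (weightedSum-cong x (component-indicator component))

      pendants-agree : ¬ (ρ + 1# ≈ 0#) → ∀ {w w′} → IsPendant w → IsPendant w′ → x w′ ≈ x w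
      pendants-agree ρ+1≉0 w-pendant w′-pendant =
        *-cancelˡ-≉0 ρ+1≉0 (trans (pendant-row w′-pendant) (sym (pendant-row w-pendant)))

      pendant-mass : ¬ (ρ + 1# ≈ 0#) → ∀ {w r} → IsPendant w → ∣ E e ∣ ≡ r →
        mass (𝟙 ∘ pendant?) ≈ fromℕ (r ∸ 2) * x w
      pendant-mass ρ+1≉0 w-pendant ∣e∣≡r =
        trans (weightedSum-constant-on-support x (𝟙 ∘ pendant?) (λ z → pendants-agree ρ+1≉0 w-pendant ∘ pendant-of z))
              (*-congʳ (reflexive (≡.cong fromℕ (pendant-count ∣e∣≡r))))
        where
        pendant-of : ∀ z → 𝟙 (pendant? z) ≢ 0 → IsPendant z
        pendant-of z nonzero with pendant? z
        ... | yes z-pendant = z-pendant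
        ... | no _       = ⊥-elim (nonzero ≡.refl)

      total-mass : mass (𝟙 ∘ pendant?) + mass (anchoredAt a) + mass (anchoredAt b) ≈ Σᶠ x
      total-mass = begin
        mass (𝟙 ∘ pendant?) + mass (anchoredAt a) + mass (anchoredAt b)
          ≈⟨ +-congʳ (weightedSum-+ x (𝟙 ∘ pendant?) (anchoredAt a)) ⟨
        mass (λ z → 𝟙 (pendant? z) +ℕ anchoredAt a z) + mass (anchoredAt b)
          ≈⟨ weightedSum-+ x (λ z → 𝟙 (pendant? z) +ℕ anchoredAt a z) (anchoredAt b) ⟨
        mass (λ z → 𝟙 (pendant? z) +ℕ anchoredAt a z +ℕ anchoredAt b z)
          ≈⟨ weightedSum-cong x anchor-partition ⟩
        mass (λ _ → 1)
          ≈⟨ weightedSum-ones x ⟩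
        Σᶠ x
          ∎

      u-row : ∀ {C w} → IsComponentMinus E e a C → IsPendant w → ρ * x a + Σ∈ C x ≈ (ρ + 1#) * x w
      u-row component w-pendant =
        trans (+-congˡ (component-mass component)) (trans (edge-row a∈e) (sym (pendant-row w-pendant)))

      v-row : ¬ (ρ + 1# ≈ 0#) → ∀ {C w r} → IsComponentMinus E e a C → IsPendant w → ∣ E e ∣ ≡ r →
        ρ * x b + Σᶠ x ≈ (ρ + 1#) * x w + fromℕ (r ∸ 2) * x w + Σ∈ C x
      v-row ρ+1≉0 {C} {w} {r} component w-pendant ∣e∣≡r = begin
        ρ * x b + Σᶠ x                       ≈⟨ +-congˡ total-mass ⟨
        ρ * x b + (P + Mₐ + M_b)             ≈⟨ regroup (ρ * x b) P Mₐ M_b ⟩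
        ρ * x b + M_b + P + Mₐ               ≈⟨ +-cong (+-cong b-row (pendant-mass ρ+1≉0 w-pendant ∣e∣≡r))
                                                       (sym (component-mass component)) ⟩
        (ρ + 1#) * x w + fromℕ (r ∸ 2) * x w + Σ∈ C x  ∎
        where
        b-row : ρ * x b + mass (anchoredAt b) ≈ (ρ + 1#) * x w
        b-row = trans (edge-row b∈e) (sym (pendant-row w-pendant))
        regroup : ∀ v p a b → v + (p + a + b) ≈ v + b + p + a
        regroup = solve 4 (λ v p a b → v :+ (p :+ a :+ b) := v :+ b :+ p :+ a) refl
        P Mₐ M_b : Carrier
        P = mass (𝟙 ∘ pendant?)
        Mₐ = mass (anchoredAt a)
        M_b = mass (anchoredAt b)

m≤1+n⇒m≢n+2 : ∀ {m n} → m ≤ suc n → m ≢ n +ℕ 2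
m≤1+n⇒m≢n+2 {n = n} m≤1+n m≡n+2 = ℕ.1+n≰n (ℕ.≤-trans (ℕ.≤-reflexive (≡.trans (ℕ.+-comm 2 n) (≡.sym m≡n+2))) m≤1+n)

lemma3p1 : ∀ {c ℓ₁ ℓ₂ : Level} (F : OrderedField c ℓ₁ ℓ₂) →
    let open OrderedField F
        open Spectral F
    in
    ∀ (n m : ℕ) (E : Fin m → Subset n) (r : ℕ) → 3 ≤ r → IsHypertree E →
    ∀ (e₁ e₂ : Fin m) → e₁ ≢ e₂ → ∣ E e₁ ∣ ≡ r → ∣ E e₂ ∣ ≡ r →
    ∀ (u₁ v₁ u₂ v₂ : Fin n) → u₁ ∈ E e₁ → v₁ ∈ E e₁ → u₂ ∈ E e₂ → v₂ ∈ E e₂ →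
    ∀ (d : Fin n → Fin n → ℕ) → IsDistance E d →
    d u₁ u₂ ≡ d v₁ v₂ +ℕ 2 →
    (∀ w → w ∈ E e₁ → w ≢ u₁ → w ≢ v₁ → degree E w ≡ 1) →
    (∀ w → w ∈ E e₂ → w ≢ u₂ → w ≢ v₂ → degree E w ≡ 1) →
    ∀ (C₁ C₂ : Subset n) → IsComponentMinus E e₁ u₁ C₁ → IsComponentMinus E e₂ u₂ C₂ →
    ∀ (ρ : Carrier) (x : Fin n → Carrier) →
    IsLargestEigenvalue d ρ → IsPerronVector d ρ x →
    ∀ (w₁ w₂ : Fin n) → w₁ ∈ E e₁ → w₁ ≢ u₁ → w₁ ≢ v₁ → w₂ ∈ E e₂ → w₂ ≢ u₂ → w₂ ≢ v₂ →
    ((ρ * (x u₁ - x u₂)) - ((ρ + 1#) * (x w₁ - x w₂))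
       ≈ (Σ∈ C₂ x - Σ∈ C₁ x))
    ×
    (((ρ + 1#) * (x w₁ - x w₂)) - (ρ * (x v₁ - x v₂))
       ≈ ((fromℕ (r ∸ 2) * (x w₂ - x w₁)) + (Σ∈ C₂ x - Σ∈ C₁ x)))
lemma3p1 F n m E r _ (_ , connected , acyclic) e₁ e₂ _ ∣e₁∣≡r ∣e₂∣≡r u₁ v₁ u₂ v₂ u₁∈e₁ v₁∈e₁ u₂∈e₂ v₂∈e₂
         d isD d-gap pendant-degree₁ pendant-degree₂ C₁ C₂ component₁ component₂ ρ x _ (eigen , positive , _)
         w₁ w₂ w₁∈e₁ w₁≢u₁ w₁≢v₁ w₂∈e₂ w₂≢u₂ w₂≢v₂ =
  difference-of-rows₁ (side₁.u-row component₁ pendant₁) (side₂.u-row component₂ pendant₂) ,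
  difference-of-rows₂ (side₁.v-row ρ+1≉0 component₁ pendant₁ ∣e₁∣≡r) (side₂.v-row ρ+1≉0 component₂ pendant₂ ∣e₂∣≡r)
  where
  open OrderedField F
  open OrderedFieldProperties F
  open RowDifferences commRing
  open LoosePaths.Distance E d isD
  u₁≢v₁ : u₁ ≢ v₁
  u₁≢v₁ ≡.refl = m≤1+n⇒m≢n+2 (d-stepʳ e₂ u₂∈e₂ v₂∈e₂) d-gap
  u₂≢v₂ : u₂ ≢ v₂
  u₂≢v₂ ≡.refl = m≤1+n⇒m≢n+2 (d-stepˡ e₁ u₁∈e₁ v₁∈e₁) d-gap
  ρ+1≉0 : ¬ (ρ + 1# ≈ 0#)
  ρ+1≉0 = nonneg⇒+1≉0 (nonneg-eigenvalue d eigen positive u₁)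
  pendant₁ : w₁ ∈ E e₁ × w₁ ≢ u₁ × w₁ ≢ v₁
  pendant₁ = w₁∈e₁ , w₁≢u₁ , w₁≢v₁
  pendant₂ : w₂ ∈ E e₂ × w₂ ≢ u₂ × w₂ ≢ v₂
  pendant₂ = w₂∈e₂ , w₂≢u₂ , w₂≢v₂
  module side₁ = CutEdge.Rows.Eigenvector E connected acyclic e₁ u₁∈e₁ v₁∈e₁ u₁≢v₁ pendant-degree₁ F d isD ρ x eigen
  module side₂ = CutEdge.Rows.Eigenvector E connected acyclic e₂ u₂∈e₂ v₂∈e₂ u₂≢v₂ pendant-degree₂ F d isD ρ x eigen
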